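{- For integers $n\ge 0$, $m\ge 0$, let $A^{Q}(n,m)$ denote the number of vertically constrained $S_{MW}$ paths from $(0,0)$ to $(n,m)$ all of whose vertices have nonnegative $y$-coordinate (first step arbitrary). Then $A^{Q}(0,m)=1$ if $m\in\{0,1\}$ and $0$ otherwise, and for all $n\ge1$: $$A^{Q}(n,0)=A^{Q}(n-1,2)+2A^{Q}(n-1,1)+2A^{Q}(n-1,0),$$ $$A^{Q}(n,1)=A^{Q}(n-1,3)+2A^{Q}(n-1,2)+3A^{Q}(n-1,1)+2A^{Q}(n-1,0),$$ and for $m\ge 2$, $$A^{Q}(n,m)=A^{Q}(n-1,m+2)+2A^{Q}(n-1,m+1)+3A^{Q}(n-1,m)+2A^{Q}(n-1,m-1)+A^{Q}(n-1,m-2).$$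
   Context: A lattice path is a finite sequence of steps (vectors in $\mathbb{Z}^2$) starting at $(0,0)$; its vertices are the partial sums, and it terminates at the last vertex (the empty path terminates at $(0,0)$). Let $S_{M}=\{(1,0),(1,1),(1,-1)\}$ and $S_{MW}=S_M\cup\{(0,1),(0,-1)\}$; the steps $(0,1),(0,-1)$ are called vertical. A vertically constrained $S_{MW}$ path is a lattice path with steps in $S_{MW}$ in which no two consecutive steps are both vertical. -}

module Defs where

open import Data.Bool using (Bool; true; false; _∧_; not; T)
open import Data.Integer using (ℤ; +_; -[1+_]; _+_; _≤_; 0ℤ; 1ℤ; -1ℤ)
open import Data.List using (List; []; _∷_)
open import Data.Nat using (ℕ)
open import Data.Product using (Σ; _×_; _,_)
open import Data.Unit using (⊤)
open import Relation.Binary.PropositionalEquality using (_≡_)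

data Step : Set where
  E NE SE U D : Step

dx : Step → ℤ
dx E  = 1ℤ
dx NE = 1ℤ
dx SE = 1ℤ
dx U  = 0ℤ
dx D  = 0ℤ

dy : Step → ℤ
dy E  = 0ℤ
dy NE = 1ℤ
dy SE = -1ℤ
dy U  = 1ℤ
dy D  = -1ℤ

vertical : Step → Bool
vertical U = true
vertical D = true
vertical _ = false

Path : Set
Path = List Step

endpoint : Path → ℤ × ℤ
endpoint []      = 0ℤ , 0ℤ
endpoint (s ∷ p) with endpoint p
... | x , y = dx s + x , dy s + y

VertConstrained : Path → Set
VertConstrained []            = ⊤
VertConstrained (s ∷ [])      = ⊤
VertConstrained (s ∷ t ∷ p)   = T (not (vertical s ∧ vertical t)) × VertConstrained (t ∷ p)

NonnegFrom : ℤ → Path → Set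
NonnegFrom y []      = 0ℤ ≤ y
NonnegFrom y (s ∷ p) = (0ℤ ≤ y) × NonnegFrom (y + dy s) p

QPath : ℕ → ℕ → Set
QPath n m = Σ Path λ p → VertConstrained p × NonnegFrom 0ℤ p × (endpoint p ≡ (+ n , + m))

-- Cut a path of run n + 1 just before its last non-vertical step. Since no two vertical
-- steps are adjacent, what follows is a block: a non-vertical step followed by at most one
-- vertical step. Walking a block backwards from height m determines the height it must
-- start from, and the walk stays at heights ≥ 0 exactly when the block does; so
-- A(n + 1, m) is the sum, over the nine blocks, of A(n, start height). Up to the blocks
-- that would dip below 0 near height 0, the nine blocks change the height by
-- +2, +1, 0, −1, −2 with multiplicities 1, 2, 3, 2, 1.
module Submission where

open import Defs
open import Axiom.UniquenessOfIdentityProofs using (module Decidable⇒UIP)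
open import Data.Bool using (false; T; not; _∧_)
open import Data.Bool.Properties using (T-irrelevant; ∧-zeroʳ)
open import Data.Fin using (Fin)
open import Data.Fin.Properties using (+↔⊎)
open import Data.Integer using (ℤ; +_; 0ℤ; 1ℤ; +≤+; ∣_∣) renaming (_+_ to _+ℤ_; _≤_ to _≤ℤ_)
import Data.Integer.Properties as ℤ
open import Data.List using ([]; _∷_; _++_)
open import Data.Maybe using (Maybe; just; nothing; maybe; _>>=_)
import Data.Maybe.Properties as Maybe
open import Data.Nat using (ℕ; zero; suc; _+_; _*_; z≤n)
import Data.Nat.Properties as ℕ
open import Data.Nat.Tactic.RingSolver using (solve-∀)
open import Data.Product using (Σ; _×_; _,_; proj₁; proj₂)
import Data.Product.Properties as Product
open import Data.Sum using (_⊎_; inj₁; inj₂)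
open import Data.Sum.Function.Propositional using (_⊎-cong_)
open import Data.Unit using (tt)
open import Function.Bundles using (_↔_; mk↔ₛ′)
open import Function.Properties.Inverse using (↔-refl; ↔-sym; ↔-trans)
open import Relation.Binary.PropositionalEquality
open import Relation.Nullary using (Irrelevant)

run height : Path → ℤ
run p = proj₁ (endpoint p)
height p = proj₂ (endpoint p)

Connects : Path → ℤ → ℤ → Set
Connects p y z = NonnegFrom y p × (y +ℤ height p ≡ z)

NonnegFrom-head : ∀ p {y} → NonnegFrom y p → 0ℤ ≤ℤ y
NonnegFrom-head []      nn = nn
NonnegFrom-head (_ ∷ _) nn = proj₁ nn

Connects-++⁻ : ∀ p {r y z} → Connects (p ++ r) y z → Σ ℤ λ w → Connects p y w × Connects r w z
Connects-++⁻ []      {r} {y} c = y , (NonnegFrom-head r (proj₁ c) , ℤ.+-identityʳ y) , c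
Connects-++⁻ (s ∷ p) {r} {y} ((0≤y , nn) , e)
  with Connects-++⁻ p (nn , trans (ℤ.+-assoc y (dy s) (height (p ++ r))) e)
... | w , (nnp , ep) , cr = w , ((0≤y , nnp) , trans (sym (ℤ.+-assoc y (dy s) (height p))) ep) , cr

Connects-++⁺ : ∀ p {r y w z} → Connects p y w → Connects r w z → Connects (p ++ r) y z
Connects-++⁺ []      {r} {y} {z = z} (_ , e) cr =
  subst (λ u → Connects r u z) (trans (sym e) (ℤ.+-identityʳ y)) cr
Connects-++⁺ (s ∷ p) {r} {y} ((0≤y , nnp) , e) cr
  with Connects-++⁺ p (nnp , trans (ℤ.+-assoc y (dy s) (height p)) e) cr
... | nn , e′ = (0≤y , nn) , trans (sym (ℤ.+-assoc y (dy s) (height (p ++ r)))) e′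

below : ℕ → Maybe ℕ
below zero    = nothing
below (suc z) = just z

heightBefore : Step → ℕ → Maybe ℕ
heightBefore E  z = just z
heightBefore NE z = below z
heightBefore U  z = below z
heightBefore SE z = just (suc z)
heightBefore D  z = just (suc z)

heightBefore-sound : ∀ s {y z} → heightBefore s z ≡ just y → + y +ℤ dy s ≡ + z
heightBefore-sound E  refl = ℤ.+-identityʳ _
heightBefore-sound NE {y} {suc z} refl = cong +_ (ℕ.+-comm y 1)
heightBefore-sound U  {y} {suc z} refl = cong +_ (ℕ.+-comm y 1)
heightBefore-sound SE refl = refl
heightBefore-sound D  refl = refl

heightBefore-complete : ∀ s {y z} → + y +ℤ dy s ≡ + z → heightBefore s z ≡ just y
heightBefore-complete E  {y} e = cong just (sym (ℤ.+-injective (trans (sym (ℤ.+-identityʳ (+ y))) e)))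
heightBefore-complete NE {y} e rewrite sym (ℤ.+-injective e) | ℕ.+-comm y 1 = refl
heightBefore-complete U  {y} e rewrite sym (ℤ.+-injective e) | ℕ.+-comm y 1 = refl
heightBefore-complete SE {suc y} refl = refl
heightBefore-complete D  {suc y} refl = refl

startHeight : Path → ℕ → Maybe ℕ
startHeight []      m = just m
startHeight (s ∷ p) m = startHeight p m >>= heightBefore s

startHeight-sound : ∀ p {y m} → startHeight p m ≡ just y → Connects p (+ y) (+ m)
startHeight-sound []      refl = +≤+ z≤n , ℤ.+-identityʳ _
startHeight-sound (s ∷ p) {y} {m} e with startHeight p m in eq
... | just z with startHeight-sound p eq
...   | nn , e′ = (+≤+ z≤n , subst (λ w → NonnegFrom w p) (sym step) nn)
                , trans (sym (ℤ.+-assoc (+ y) (dy s) (height p))) (trans (cong (_+ℤ height p) step) e′)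
  where step = heightBefore-sound s e

startHeight-complete : ∀ p {y m} → Connects p (+ y) (+ m) → startHeight p m ≡ just y
startHeight-complete []      {y} (_ , e) = cong just (sym (ℤ.+-injective (trans (sym (ℤ.+-identityʳ (+ y))) e)))
startHeight-complete (s ∷ p) {y} {m} ((_ , nn) , e) = begin
  (startHeight p m >>= heightBefore s) ≡⟨ cong (_>>= heightBefore s) (startHeight-complete p (nn′ , e′)) ⟩
  heightBefore s ∣ w ∣                  ≡⟨ heightBefore-complete s (sym w≡) ⟩
  just y                                ∎
  where
  open ≡-Reasoning
  w = + y +ℤ dy s
  w≡ : + ∣ w ∣ ≡ w
  w≡ = ℤ.0≤i⇒+∣i∣≡i (NonnegFrom-head p nn)
  nn′ : NonnegFrom (+ ∣ w ∣) p
  nn′ = subst (λ u → NonnegFrom u p) (sym w≡) nn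
  e′ : + ∣ w ∣ +ℤ height p ≡ + m
  e′ = trans (cong (_+ℤ height p) w≡) (trans (ℤ.+-assoc (+ y) (dy s) (height p)) e)

data Dir : Set where
  flat up down : Dir

hstep : Dir → Step
hstep flat = E
hstep up   = NE
hstep down = SE

vtail : Dir → Path
vtail flat = []
vtail up   = U ∷ []
vtail down = D ∷ []

hstep-not-vertical : ∀ h → vertical (hstep h) ≡ false
hstep-not-vertical flat = refl
hstep-not-vertical up   = refl
hstep-not-vertical down = refl

block : Dir → Dir → Path
block h v = hstep h ∷ vtail v

run-vtail : ∀ v → run (vtail v) ≡ 0ℤ
run-vtail flat = refl
run-vtail up   = refl
run-vtail down = refl

run-block : ∀ h v → run (block h v) ≡ 1ℤ
run-block flat v rewrite run-vtail v = refl
run-block up   v rewrite run-vtail v = refl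
run-block down v rewrite run-vtail v = refl

run-++ : ∀ p r → run (p ++ r) ≡ run p +ℤ run r
run-++ []      r = sym (ℤ.+-identityˡ (run r))
run-++ (s ∷ p) r = trans (cong (dx s +ℤ_) (run-++ p r)) (sym (ℤ.+-assoc (dx s) (run p) (run r)))

run-nonneg : ∀ p → 0ℤ ≤ℤ run p
run-nonneg []      = +≤+ z≤n
run-nonneg (s ∷ p) = ℤ.+-mono-≤ (dx-nonneg s) (run-nonneg p)
  where
  dx-nonneg : ∀ s → 0ℤ ≤ℤ dx s
  dx-nonneg E  = +≤+ z≤n
  dx-nonneg NE = +≤+ z≤n
  dx-nonneg SE = +≤+ z≤n
  dx-nonneg U  = +≤+ z≤n
  dx-nonneg D  = +≤+ z≤n

run-++-block⁻ : ∀ q h v {n} → run (q ++ block h v) ≡ + n → Σ ℕ λ k → n ≡ suc k × run q ≡ + k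
run-++-block⁻ q h v {n} e = ∣ run q ∣ , n≡ , sym q≡
  where
  q≡ : + ∣ run q ∣ ≡ run q
  q≡ = ℤ.0≤i⇒+∣i∣≡i (run-nonneg q)
  n≡ : n ≡ suc ∣ run q ∣
  n≡ = ℤ.+-injective (begin
    + n                     ≡⟨ sym e ⟩
    run (q ++ block h v)    ≡⟨ run-++ q (block h v) ⟩
    run q +ℤ run (block h v) ≡⟨ cong₂ _+ℤ_ (sym q≡) (run-block h v) ⟩
    + (∣ run q ∣ + 1)       ≡⟨ cong +_ (ℕ.+-comm ∣ run q ∣ 1) ⟩
    + suc ∣ run q ∣         ∎)
    where open ≡-Reasoning

run-++-block⁺ : ∀ q h v {n} → run q ≡ + n → run (q ++ block h v) ≡ + suc n
run-++-block⁺ q h v {n} e = begin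
  run (q ++ block h v)     ≡⟨ run-++ q (block h v) ⟩
  run q +ℤ run (block h v) ≡⟨ cong₂ _+ℤ_ e (run-block h v) ⟩
  + (n + 1)                ≡⟨ cong +_ (ℕ.+-comm n 1) ⟩
  + suc n                  ∎
  where open ≡-Reasoning

VertConstrained-tail : ∀ s p → VertConstrained (s ∷ p) → VertConstrained p
VertConstrained-tail _ []      _        = tt
VertConstrained-tail _ (_ ∷ _) (_ , vc) = vc

VertConstrained-++⁻ : ∀ q {r} → VertConstrained (q ++ r) → VertConstrained q
VertConstrained-++⁻ []          _         = tt
VertConstrained-++⁻ (_ ∷ [])    _         = tt
VertConstrained-++⁻ (_ ∷ t ∷ q) (ok , vc) = ok , VertConstrained-++⁻ (t ∷ q) vc

VertConstrained-++-block : ∀ q h v → VertConstrained q → VertConstrained (q ++ block h v)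
VertConstrained-++-block []          h flat _         = tt
VertConstrained-++-block []          h up   _         rewrite hstep-not-vertical h = tt , tt
VertConstrained-++-block []          h down _         rewrite hstep-not-vertical h = tt , tt
VertConstrained-++-block (s ∷ [])    h v    _         = junction , VertConstrained-++-block [] h v tt
  where
  junction : T (not (vertical s ∧ vertical (hstep h)))
  junction rewrite hstep-not-vertical h | ∧-zeroʳ (vertical s) = tt
VertConstrained-++-block (_ ∷ t ∷ q) h v    (ok , vc) = ok , VertConstrained-++-block (t ∷ q) h v vc

data Shape : Path → Set where
  tail-only : ∀ v → Shape (vtail v)
  ending    : ∀ q h v → Shape (q ++ block h v)

shape-∷vtail : ∀ s v → VertConstrained (s ∷ vtail v) → Shape (s ∷ vtail v)
shape-∷vtail E  v    _        = ending [] flat v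
shape-∷vtail NE v    _        = ending [] up v
shape-∷vtail SE v    _        = ending [] down v
shape-∷vtail U  flat _        = tail-only up
shape-∷vtail D  flat _        = tail-only down
shape-∷vtail U  up   (() , _)
shape-∷vtail U  down (() , _)
shape-∷vtail D  up   (() , _)
shape-∷vtail D  down (() , _)

shape : ∀ p → VertConstrained p → Shape p
shape []      _  = tail-only flat
shape (s ∷ p) vc with shape p (VertConstrained-tail s p vc)
... | tail-only v  = shape-∷vtail s v vc
... | ending q h v = ending (s ∷ q) h v

shape-vtail : ∀ v vc → shape (vtail v) vc ≡ tail-only v
shape-vtail flat _ = refl
shape-vtail up   _ = refl
shape-vtail down _ = refl

shape-++-block : ∀ q h v vc → shape (q ++ block h v) vc ≡ ending q h v
shape-++-block [] h v vc rewrite shape-vtail v (VertConstrained-tail (hstep h) (vtail v) vc) with h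
... | flat = refl
... | up   = refl
... | down = refl
shape-++-block (s ∷ q) h v vc
  rewrite shape-++-block q h v (VertConstrained-tail s (q ++ block h v) vc) = refl

VertConstrained-irrelevant : ∀ p → Irrelevant (VertConstrained p)
VertConstrained-irrelevant []          _       _         = refl
VertConstrained-irrelevant (_ ∷ [])    _       _         = refl
VertConstrained-irrelevant (_ ∷ t ∷ p) (a , b) (a′ , b′) =
  cong₂ _,_ (T-irrelevant a a′) (VertConstrained-irrelevant (t ∷ p) b b′)

NonnegFrom-irrelevant : ∀ y p → Irrelevant (NonnegFrom y p)
NonnegFrom-irrelevant y []      a       a′        = ℤ.≤-irrelevant a a′
NonnegFrom-irrelevant y (s ∷ p) (a , b) (a′ , b′) =
  cong₂ _,_ (ℤ.≤-irrelevant a a′) (NonnegFrom-irrelevant (y +ℤ dy s) p b b′)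

≡-irrelevant-Maybeℕ : {s t : Maybe ℕ} → Irrelevant (s ≡ t)
≡-irrelevant-Maybeℕ = Decidable⇒UIP.≡-irrelevant (Maybe.≡-dec ℕ._≟_)

QPath-≡ : ∀ {n m} (x x′ : QPath n m) → proj₁ x ≡ proj₁ x′ → x ≡ x′
QPath-≡ (p , vc , nn , ep) (.p , vc′ , nn′ , ep′) refl
  rewrite VertConstrained-irrelevant p vc vc′
        | NonnegFrom-irrelevant 0ℤ p nn nn′
        | Decidable⇒UIP.≡-irrelevant (Product.≡-dec ℤ._≟_ ℤ._≟_) ep ep′ = refl

qpath : ∀ {n m} p → VertConstrained p → Connects p 0ℤ (+ m) → run p ≡ + n → QPath n m
qpath p vc (nn , e) r = p , vc , nn , cong₂ _,_ r (trans (sym (ℤ.+-identityˡ (height p))) e)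

QPath-connects : ∀ {n m} (x : QPath n m) → Connects (proj₁ x) 0ℤ (+ m)
QPath-connects (p , _ , nn , ep) = nn , trans (ℤ.+-identityˡ (height p)) (cong proj₂ ep)

QPath-run : ∀ {n m} (x : QPath n m) → run (proj₁ x) ≡ + n
QPath-run (_ , _ , _ , ep) = cong proj₁ ep

Connects-++-block⁻ : ∀ q h v {m} → Connects (q ++ block h v) 0ℤ (+ m)
                   → Σ ℕ λ y → Connects q 0ℤ (+ y) × Connects (block h v) (+ y) (+ m)
Connects-++-block⁻ q h v {m} c with Connects-++⁻ q c
... | w , cq , cb = ∣ w ∣ , subst (Connects q 0ℤ) (sym w≡) cq
                          , subst (λ u → Connects (block h v) u (+ m)) (sym w≡) cb
  where
  w≡ : + ∣ w ∣ ≡ w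
  w≡ = ℤ.0≤i⇒+∣i∣≡i (proj₁ (proj₁ cb))

QPath-zero↔ : ∀ m → QPath 0 m ↔ (Σ Dir λ v → startHeight (vtail v) m ≡ just 0)
QPath-zero↔ m = mk↔ₛ′ to from to∘from from∘to
  where
  VertConstrained-vtail : ∀ v → VertConstrained (vtail v)
  VertConstrained-vtail flat = tt
  VertConstrained-vtail up   = tt
  VertConstrained-vtail down = tt

  toTail : ∀ {p} → Shape p → Connects p 0ℤ (+ m) → run p ≡ + 0 → Σ Dir λ v → startHeight (vtail v) m ≡ just 0
  toTail (tail-only v)  c _ = v , startHeight-complete (vtail v) c
  toTail (ending q h v) _ r with run-++-block⁻ q h v r
  ... | _ , () , _

  to : QPath 0 m → Σ Dir λ v → startHeight (vtail v) m ≡ just 0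
  to x@(p , vc , _) = toTail (shape p vc) (QPath-connects x) (QPath-run x)

  from : (Σ Dir λ v → startHeight (vtail v) m ≡ just 0) → QPath 0 m
  from (v , e) = qpath (vtail v) (VertConstrained-vtail v) (startHeight-sound (vtail v) e) (run-vtail v)

  to∘from : ∀ t → to (from t) ≡ t
  to∘from (v , e) rewrite shape-vtail v (VertConstrained-vtail v) =
    cong (v ,_) (≡-irrelevant-Maybeℕ _ e)

  from∘to : ∀ x → from (to x) ≡ x
  from∘to x@(p , vc , _) = QPath-≡ (from (to x)) x (path (shape p vc) (QPath-connects x) (QPath-run x))
    where
    path : ∀ {p} (sh : Shape p) c r → proj₁ (from (toTail sh c r)) ≡ p
    path (tail-only v)  c r = refl
    path (ending q h v) c r with run-++-block⁻ q h v r
    ... | _ , () , _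

Extensions : ℕ → ℕ → Set
Extensions n m = Σ Dir λ h → Σ Dir λ v → Σ ℕ λ y → startHeight (block h v) m ≡ just y × QPath n y

extension-≡ : ∀ {n m h v y y′} {e : startHeight (block h v) m ≡ just y} {e′ : startHeight (block h v) m ≡ just y′}
              (x : QPath n y) (x′ : QPath n y′) → proj₁ x ≡ proj₁ x′
            → _≡_ {A = Extensions n m} (h , v , y , e , x) (h , v , y′ , e′ , x′)
extension-≡ {e = e} {e′} x@(p , _) x′@(.p , _) refl
  with ℤ.+-injective (trans (sym (proj₂ (QPath-connects x))) (proj₂ (QPath-connects x′)))
... | refl rewrite ≡-irrelevant-Maybeℕ e e′ | QPath-≡ x x′ refl = refl

QPath-suc↔ : ∀ n m → QPath (suc n) m ↔ Extensions n m
QPath-suc↔ n m = mk↔ₛ′ to from to∘from from∘to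
  where
  split : ∀ {p} → Shape p → VertConstrained p → Connects p 0ℤ (+ m) → run p ≡ + suc n → Extensions n m
  split (tail-only v) _ _ r with trans (sym (run-vtail v)) r
  ... | ()
  split (ending q h v) vc c r =
    let y , cq , cb = Connects-++-block⁻ q h v c
        k , n≡ , rq = run-++-block⁻ q h v r
    in h , v , y , startHeight-complete (block h v) cb
         , qpath q (VertConstrained-++⁻ q vc) cq (trans rq (cong +_ (ℕ.suc-injective (sym n≡))))

  to : QPath (suc n) m → Extensions n m
  to x@(p , vc , _) = split (shape p vc) vc (QPath-connects x) (QPath-run x)

  from : Extensions n m → QPath (suc n) m
  from (h , v , y , e , x@(q , vc , _)) =
    qpath (q ++ block h v) (VertConstrained-++-block q h v vc)
          (Connects-++⁺ q (QPath-connects x) (startHeight-sound (block h v) e)) (run-++-block⁺ q h v (QPath-run x))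

  to∘from : ∀ t → to (from t) ≡ t
  to∘from (h , v , y , e , x@(q , vc , _))
    rewrite shape-++-block q h v (VertConstrained-++-block q h v vc) = extension-≡ _ x refl

  from∘to : ∀ x → from (to x) ≡ x
  from∘to x@(p , vc , _) = QPath-≡ (from (to x)) x (path (shape p vc) vc (QPath-connects x) (QPath-run x))
    where
    path : ∀ {p} (sh : Shape p) vc c r → proj₁ (from (split sh vc c r)) ≡ p
    path (tail-only v)  _ _ r with trans (sym (run-vtail v)) r
    ... | ()
    path (ending q h v) _ _ _ = refl

∑Dir : (Dir → ℕ) → ℕ
∑Dir f = f flat + f up + f down

Σ-Dir↔ : ∀ {G : Dir → Set} {f : Dir → ℕ} → (∀ d → G d ↔ Fin (f d)) → Σ Dir G ↔ Fin (∑Dir f)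
Σ-Dir↔ {G} {f} count =
  ↔-trans Σ-Dir↔⊎ (↔-trans ((count flat ⊎-cong count up) ⊎-cong count down)
                           (↔-sym (↔-trans +↔⊎ (+↔⊎ ⊎-cong ↔-refl))))
  where
  Σ-Dir↔⊎ : Σ Dir G ↔ ((G flat ⊎ G up) ⊎ G down)
  Σ-Dir↔⊎ = mk↔ₛ′ split join split∘join join∘split
    where
    split : Σ Dir G → (G flat ⊎ G up) ⊎ G down
    split (flat , x) = inj₁ (inj₁ x)
    split (up   , x) = inj₁ (inj₂ x)
    split (down , x) = inj₂ x
    join : (G flat ⊎ G up) ⊎ G down → Σ Dir G
    join (inj₁ (inj₁ x)) = flat , x
    join (inj₁ (inj₂ x)) = up , x
    join (inj₂ x)        = down , x
    split∘join : ∀ x → split (join x) ≡ x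
    split∘join (inj₁ (inj₁ _)) = refl
    split∘join (inj₁ (inj₂ _)) = refl
    split∘join (inj₂ _)        = refl
    join∘split : ∀ x → join (split x) ≡ x
    join∘split (flat , _) = refl
    join∘split (up   , _) = refl
    join∘split (down , _) = refl

Σ-≡just↔ : ∀ {X : ℕ → Set} {f : ℕ → ℕ} → (∀ y → X y ↔ Fin (f y))
         → ∀ s → (Σ ℕ λ y → s ≡ just y × X y) ↔ Fin (maybe f 0 s)
Σ-≡just↔ count nothing  = mk↔ₛ′ (λ { (_ , () , _) }) (λ ()) (λ ()) (λ { (_ , () , _) })
Σ-≡just↔ count (just y) = ↔-trans
  (mk↔ₛ′ (λ { (_ , refl , x) → x }) (λ x → y , refl , x) (λ _ → refl) (λ { (_ , refl , _) → refl }))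
  (count y)

atOrigin : ℕ → ℕ
atOrigin zero    = 1
atOrigin (suc _) = 0

≡just-zero↔ : ∀ s → (s ≡ just 0) ↔ Fin (maybe atOrigin 0 s)
≡just-zero↔ nothing        = mk↔ₛ′ (λ ()) (λ ()) (λ ()) (λ ())
≡just-zero↔ (just (suc _)) = mk↔ₛ′ (λ ()) (λ ()) (λ ()) (λ ())
≡just-zero↔ (just zero)    = mk↔ₛ′ (λ _ → Fin.zero) (λ _ → refl) (λ { Fin.zero → refl ; (Fin.suc ()) })
                               (≡-irrelevant-Maybeℕ refl)

A : ℕ → ℕ → ℕ
A zero    m = ∑Dir λ v → maybe atOrigin 0 (startHeight (vtail v) m)
A (suc n) m = ∑Dir λ h → ∑Dir λ v → maybe (A n) 0 (startHeight (block h v) m)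

QPath↔Fin-A : ∀ n m → QPath n m ↔ Fin (A n m)
QPath↔Fin-A zero    m = ↔-trans (QPath-zero↔ m) (Σ-Dir↔ λ v → ≡just-zero↔ _)
QPath↔Fin-A (suc n) m = ↔-trans (QPath-suc↔ n m) (Σ-Dir↔ λ h → Σ-Dir↔ λ v → Σ-≡just↔ (QPath↔Fin-A n) _)

lemma2 : Σ (ℕ → ℕ → ℕ) λ A →
           ((n m : ℕ) → QPath n m ↔ Fin (A n m))
           × (A 0 0 ≡ 1)
           × (A 0 1 ≡ 1)
           × ((m : ℕ) → A 0 (suc (suc m)) ≡ 0)
           × ((n : ℕ) → A (suc n) 0 ≡ A n 2 + 2 * A n 1 + 2 * A n 0)
           × ((n : ℕ) → A (suc n) 1 ≡ A n 3 + 2 * A n 2 + 3 * A n 1 + 2 * A n 0)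
           × ((n k : ℕ) → A (suc n) (suc (suc k))
               ≡ A n (4 + k) + 2 * A n (3 + k) + 3 * A n (2 + k) + 2 * A n (1 + k) + A n k)
lemma2 = A , QPath↔Fin-A , refl , refl , (λ _ → refl)
       , (λ n → at-height-0 (A n 0) (A n 1) (A n 2))
       , (λ n → at-height-1 (A n 0) (A n 1) (A n 2) (A n 3))
       , (λ n k → at-height-2+ (A n k) (A n (1 + k)) (A n (2 + k)) (A n (3 + k)) (A n (4 + k)))
  where
  -- The left-hand sides list the nine terms of A (suc n) m: the non-vertical step E, NE, SE
  -- in turn, each followed by no vertical step, U, or D.
  at-height-0 : ∀ a₀ a₁ a₂ → (a₀ + 0 + a₁) + (0 + 0 + a₀) + (a₁ + 0 + a₂) ≡ a₂ + 2 * a₁ + 2 * a₀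
  at-height-0 = solve-∀
  at-height-1 : ∀ a₀ a₁ a₂ a₃ → (a₁ + a₀ + a₂) + (a₀ + 0 + a₁) + (a₂ + a₁ + a₃)
                           ≡ a₃ + 2 * a₂ + 3 * a₁ + 2 * a₀
  at-height-1 = solve-∀
  at-height-2+ : ∀ a₀ a₁ a₂ a₃ a₄ → (a₂ + a₁ + a₃) + (a₁ + a₀ + a₂) + (a₃ + a₂ + a₄)
                               ≡ a₄ + 2 * a₃ + 3 * a₂ + 2 * a₁ + a₀
  at-height-2+ = solve-∀
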